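{- For every formula $A$ of PRA, the following are equivalent: (1) $\vdash A$; (2) $\vdash \chi A=0$; (3) $\vdash^\chi \chi A$.
   Context: PRA (Primitive Recursive Arithmetic) is the following quantifier-free formal system. Its symbols are variables, function symbols (each with an arity), $=$, $\neg$, $\vee$. Terms: variables and $f(a_1,\dots,a_n)$. Formulas: equations $a=b$, and $\neg A$, $A\vee B$; $\wedge,\to,\leftrightarrow$ are the usual abbreviations, $a\ne b$ abbreviates $\neg\,a=b$. $u_{\vec x}(\vec a)$ denotes substitution of terms $\vec a$ for variables $\vec x$. If $\vec x,y,z$ are distinct variables, $a$ a term with variables among $\vec x$, $b$ a term with variables among $\vec x,y,z$, then $f$ is defined by primitive recursion by $f(\vec x,0)=a$, $f(\vec x,Sy)=b_z(f(\vec x,y))$. PR function symbols are those having a construction: a finite sequence beginning with $0$ and $S$, each later symbol defined by primitive recursion from terms built from earlier symbols; these are the nonlogical symbols of PRA. Axioms of PRA: defining equations of PR function symbols; $\neg\,Sx=0$; $Sx=Sy\to x=y$; $x=x$; $x=y\to y=x$; $x=y\wedge A_x(x)\to A_x(y)$; $A\vee A\to A$; $A\to A\vee B$; $A\vee B\to B\vee A$; $(B\to C)\to(A\vee B\to A\vee C)$. Rules: instance, modus ponens (from $A$ and $A\to B$ infer $B$), induction (from $A_x(0)$ and $A_x(x')\to A_x(Sx')$ infer $A_x(x)$). $\vdash A$ means $A$ is a theorem of PRA. Symbols: $x+0=x$, $x+Sy=S(x+y)$; $P0=0$, $PSx=x$; $x-0=x$, $x-Sy=P(x-y)$; $C(0,y,z)=y$,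 $C(Sx,y,z)=z$; $\mathrm{Eq}(x,y)=(x-y)+(y-x)$; $x\mathrel{\dot=}y=C(\mathrm{Eq}(x,y),0,S0)$; $\dot\neg x=C(x,S0,0)$; $x\mathbin{\dot\vee}y=C(x,0,C(y,0,S0))$; $x\mathbin{\dot\to}y=\dot\neg x\mathbin{\dot\vee}y$, $x\mathbin{\dot\wedge}y=\dot\neg(\dot\neg x\mathbin{\dot\vee}\dot\neg y)$. The characteristic term $\chi A$: $\chi[a=b]$ is $a\mathrel{\dot=}b$, $\chi[\neg B]$ is $\dot\neg\chi B$, $\chi[B\vee C]$ is $\chi B\mathbin{\dot\vee}\chi C$. The formal system $\chi$PRA: its symbols are the variables and PR function symbols; its formulas ($\chi$-formulas) are built from $\chi$-equations $a\mathrel{\dot=}b$ by $\dot\neg$ and $\dot\vee$ (so $\chi$ is a bijection from formulas of PRA onto $\chi$-formulas). Its axioms are the characteristic terms $\chi D$ of the axioms $D$ of PRA; its rules are: from $\alpha$ infer an instance of $\alpha$; from $\alpha$ and $\alpha\mathbin{\dot\to}\beta$ infer $\beta$; from $\alpha_x(0)$ and $\alpha_x(x')\mathbin{\dot\to}\alpha_x(Sx')$ infer $\alpha_x(x)$. $\vdash^\chi\alpha$ means $\alpha$ is a theorem of $\chi$PRA. -}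

module Defs where

open import Data.Nat using (ℕ; zero; suc; _≟_)
open import Data.Fin using (Fin; toℕ)
open import Data.Vec using (Vec; []; _∷_; _∷ʳ_; tabulate)
open import Data.Sum using (_⊎_)
open import Data.Product using (_×_)
open import Relation.Binary.PropositionalEquality using (_≡_)
open import Relation.Nullary using (¬_; yes; no)

-- Variables of the body of a primitive-recursive definition
--   f(x⃗,0) = a ,  f(x⃗,Sy) = b_z(f(x⃗,y))
-- with x⃗ = x₀ … x_{n-1}.
data BVar (n : ℕ) : Set where
  xv : Fin n → BVar n
  yv : BVar n
  zv : BVar n

-- PR function symbols (indexed by arity) are identified with their
-- constructions; terms over a set V of variables.
mutual
  data Fun : ℕ → Set where
    𝟘   : Fun 0
    𝕊   : Fun 1
    rec : ∀ {n} → Term (Fin n) → Term (BVar n) → Fun (suc n)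

  data Term (V : Set) : Set where
    var : V → Term V
    app : ∀ {k} → Fun k → Vec (Term V) k → Term V

mutual
  sub : ∀ {V W : Set} → (V → Term W) → Term V → Term W
  sub σ (var v)    = σ v
  sub σ (app f ts) = app f (subV σ ts)

  subV : ∀ {V W : Set} {k} → (V → Term W) → Vec (Term V) k → Vec (Term W) k
  subV σ []       = []
  subV σ (t ∷ ts) = sub σ t ∷ subV σ ts

Tm : Set
Tm = Term ℕ

data Form : Set where
  _≐_ : Tm → Tm → Form
  ¬'_ : Form → Form
  _∨'_ : Form → Form → Form

infix  7 _≐_
infix  6 ¬'_
infixr 5 _∨'_
infixr 4 _∧'_
infixr 3 _⇒_

_∧'_ : Form → Form → Form
A ∧' B = ¬' (¬' A ∨' ¬' B)

_⇒_ : Form → Form → Form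
A ⇒ B = ¬' A ∨' B

_≠'_ : Tm → Tm → Form
a ≠' b = ¬' (a ≐ b)

subF : (ℕ → Tm) → Form → Form
subF σ (a ≐ b)  = sub σ a ≐ sub σ b
subF σ (¬' A)   = ¬' subF σ A
subF σ (A ∨' B) = subF σ A ∨' subF σ B

⟨_≔_⟩ : ℕ → Tm → ℕ → Tm
⟨ x ≔ t ⟩ v with v ≟ x
... | yes _ = t
... | no  _ = var v

_[_≔_]F : Form → ℕ → Tm → Form
A [ x ≔ t ]F = subF ⟨ x ≔ t ⟩ A

_[_≔_]T : Tm → ℕ → Tm → Tm
α [ x ≔ t ]T = sub ⟨ x ≔ t ⟩ α

mutual
  data OccT (v : ℕ) : Tm → Set where
    here  : OccT v (var v)
    inArg : ∀ {k} {f : Fun k} {ts : Vec Tm k} → OccV v ts → OccT v (app f ts)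

  data OccV (v : ℕ) : ∀ {k} → Vec Tm k → Set where
    hd : ∀ {k} {t} {ts : Vec Tm k} → OccT v t → OccV v (t ∷ ts)
    tl : ∀ {k} {t} {ts : Vec Tm k} → OccV v ts → OccV v (t ∷ ts)

OccF : ℕ → Form → Set
OccF v (a ≐ b)  = OccT v a ⊎ OccT v b
OccF v (¬' A)   = OccF v A
OccF v (A ∨' B) = OccF v A ⊎ OccF v B

Z : ∀ {V} → Term V
Z = app 𝟘 []

S : ∀ {V} → Term V → Term V
S t = app 𝕊 (t ∷ [])

xs : (n : ℕ) → Vec Tm n
xs n = tabulate (λ i → var (toℕ i))

data Axiom : Form → Set where
  -- defining equations of f = rec a b (x⃗ = x₀…x_{n-1}, y = x_n, z ↦ f(x⃗,y))
  defZ : ∀ {n} (a : Term (Fin n)) (b : Term (BVar n)) →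
         Axiom (app (rec a b) (xs n ∷ʳ Z) ≐ sub (λ i → var (toℕ i)) a)
  defS : ∀ {n} (a : Term (Fin n)) (b : Term (BVar n)) →
         Axiom (app (rec a b) (xs n ∷ʳ S (var n))
                  ≐ sub (λ { (xv i) → var (toℕ i)
                           ; yv → var n
                           ; zv → app (rec a b) (xs n ∷ʳ var n) }) b)
  sucNZ  : ∀ x → Axiom (S (var x) ≠' Z)
  sucInj : ∀ x y → Axiom (S (var x) ≐ S (var y) ⇒ var x ≐ var y)
  refl'  : ∀ x → Axiom (var x ≐ var x)
  sym'   : ∀ x y → Axiom (var x ≐ var y ⇒ var y ≐ var x)
  leib   : ∀ x y A → Axiom (var x ≐ var y ∧' A ⇒ A [ x ≔ var y ]F)
  contr  : ∀ A → Axiom (A ∨' A ⇒ A)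
  weak   : ∀ A B → Axiom (A ⇒ A ∨' B)
  perm   : ∀ A B → Axiom (A ∨' B ⇒ B ∨' A)
  assoc' : ∀ A B C → Axiom ((B ⇒ C) ⇒ (A ∨' B ⇒ A ∨' C))

infix 2 ⊢_ ⊢χ_

data ⊢_ : Form → Set where
  ax   : ∀ {A} → Axiom A → ⊢ A
  inst : ∀ {A} (σ : ℕ → Tm) → ⊢ A → ⊢ subF σ A
  mp   : ∀ {A B} → ⊢ A → ⊢ (A ⇒ B) → ⊢ B
  ind  : ∀ A x x' → (x' ≡ x ⊎ ¬ OccF x' A) →
         ⊢ A [ x ≔ Z ]F →
         ⊢ (A [ x ≔ var x' ]F ⇒ A [ x ≔ S (var x') ]F) →
         ⊢ A

-- x + 0 = x , x + Sy = S(x + y)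
plusF : Fun 2
plusF = rec (var Data.Fin.zero) (S (var zv))

-- P0 = 0 , PSx = x
predF : Fun 1
predF = rec Z (var yv)

-- x - 0 = x , x - Sy = P(x - y)
monusF : Fun 2
monusF = rec (var Data.Fin.zero) (app predF (var zv ∷ []))

-- C'(y,z,0) = y , C'(y,z,Sx) = z   (C with the recursion argument last)
condF : Fun 3
condF = rec (var Data.Fin.zero) (var (xv (Data.Fin.suc Data.Fin.zero)))

_+ₜ_ : Tm → Tm → Tm
a +ₜ b = app plusF (a ∷ b ∷ [])

_-ₜ_ : Tm → Tm → Tm
a -ₜ b = app monusF (a ∷ b ∷ [])

-- C(x,y,z) := C'(y,z,x), so C(0,y,z)=y, C(Sx,y,z)=z
Cₜ : Tm → Tm → Tm → Tm
Cₜ a b c = app condF (b ∷ c ∷ a ∷ [])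

Eqₜ : Tm → Tm → Tm
Eqₜ a b = (a -ₜ b) +ₜ (b -ₜ a)

_≐̇_ : Tm → Tm → Tm
a ≐̇ b = Cₜ (Eqₜ a b) Z (S Z)

¬̇_ : Tm → Tm
¬̇ a = Cₜ a (S Z) Z

_∨̇_ : Tm → Tm → Tm
a ∨̇ b = Cₜ a Z (Cₜ b Z (S Z))

infix  7 _≐̇_
infix  6 ¬̇_
infixr 5 _∨̇_
infixr 3 _→̇_
infix  8 _[_≔_]T _[_≔_]F

_→̇_ : Tm → Tm → Tm
a →̇ b = (¬̇ a) ∨̇ b

χ : Form → Tm
χ (a ≐ b)  = a ≐̇ b
χ (¬' A)   = ¬̇ χ A
χ (A ∨' B) = χ A ∨̇ χ B

data ⊢χ_ : Tm → Set where
  axχ   : ∀ {D} → Axiom D → ⊢χ χ D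
  instχ : ∀ {α} (σ : ℕ → Tm) → ⊢χ α → ⊢χ sub σ α
  mpχ   : ∀ {α β} → ⊢χ α → ⊢χ (α →̇ β) → ⊢χ β
  indχ  : ∀ α x x' → (x' ≡ x ⊎ ¬ OccT x' α) →
          ⊢χ α [ x ≔ Z ]T →
          ⊢χ (α [ x ≔ var x' ]T →̇ α [ x ≔ S (var x') ]T) →
          ⊢χ α

-- Every propositional tautology is a theorem of PRA (Kalmár's argument), which gives
-- a calculus of hypothetical reasoning inside PRA.  With it one proves A ⇔ χ A = 0
-- by induction on A; the only real arithmetic is that a ∸ b = 0 and b ∸ a = 0 imply
-- a = b.  This gives (1) ⇔ (2).  A PRA derivation of A maps rule by rule to a χPRA
-- derivation of χ A, because χ commutes with substitution and introduces no
-- variables; conversely a χPRA derivation of α becomes a PRA derivation of α = 0,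
-- modus ponens surviving because (α →̇ β) = 0 and α = 0 force β = 0.
module Submission where

open import Data.Bool using (Bool; true; false; T; _∧_; _∨_; not; if_then_else_)
open import Data.Bool.Properties using (T-∧)
open import Data.Empty using (⊥-elim)
open import Data.Fin using () renaming (zero to fzero; suc to fsuc)
open import Data.List using (List; []; _∷_)
open import Data.List.Membership.Propositional using (_∈_)
open import Data.List.Relation.Binary.Permutation.Propositional using (↭-swap; ↭-refl)
open import Data.List.Relation.Binary.Subset.Propositional using (_⊆_)
open import Data.List.Relation.Binary.Subset.Propositional.Properties using (⊆-reflexive-↭)
open import Data.List.Relation.Unary.Any using (here; there)
open import Data.Nat using (ℕ; zero; suc; _<_; _≤_; s≤s; _≡ᵇ_; _+_; _⊔_)
open import Data.Nat.Properties
  using (m<1+n⇒m<n∨m≡n; +-suc; +-identityʳ; ≤-trans; ≤-refl; <⇒≤; m≤m⊔n; m≤n⊔m)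
open import Data.Product using (_×_; _,_; proj₁; proj₂)
open import Data.Sum using (_⊎_; inj₁; inj₂; [_,_]′; swap)
import Data.Sum as Sum
open import Data.Vec using ([]; _∷_)
open import Function using (_∘_)
open import Function.Bundles using (_⇔_; mk⇔; Equivalence)
open import Relation.Binary.PropositionalEquality using (_≡_; refl; sym; cong; cong₂; subst)
open import Relation.Nullary using (¬_)

open import Defs

private variable
  A B C H X Y W : Form
  Γ Δ : List Form
  a b c : Tm
  v : ℕ

⊥' : Form
⊥' = S Z ≐ Z

⊢¬⊥' : ⊢ ¬' ⊥'
⊢¬⊥' = inst (λ _ → Z) (ax (sucNZ 0))

∨-comm : ⊢ A ∨' B → ⊢ B ∨' A
∨-comm p = mp p (ax (perm _ _))

∨-monoʳ : ⊢ B ⇒ C → ⊢ A ∨' B ⇒ A ∨' C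
∨-monoʳ {A = A} p = mp p (ax (assoc' A _ _))

⇒-trans : ⊢ A ⇒ B → ⊢ B ⇒ C → ⊢ A ⇒ C
⇒-trans p q = mp p (∨-monoʳ q)

∨-monoˡ : ⊢ A ⇒ B → ⊢ A ∨' C ⇒ B ∨' C
∨-monoˡ p = ⇒-trans (ax (perm _ _)) (⇒-trans (∨-monoʳ p) (ax (perm _ _)))

⇒-refl : ⊢ A ⇒ A
⇒-refl {A} = ⇒-trans (ax (weak A A)) (ax (contr A))

∨-injʳ : ⊢ B ⇒ A ∨' B
∨-injʳ = ⇒-trans (ax (weak _ _)) (ax (perm _ _))

∨-elim : ⊢ A ⇒ C → ⊢ B ⇒ C → ⊢ A ∨' B ⇒ C
∨-elim p q =
  ⇒-trans (∨-monoˡ p) (⇒-trans (ax (perm _ _)) (⇒-trans (∨-monoˡ q) (ax (contr _))))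

⊥'-elim : ⊢ ⊥' ⇒ A
⊥'-elim = mp ⊢¬⊥' (ax (weak _ _))

excluded-middle : ⊢ A ∨' ¬' A
excluded-middle = ∨-comm ⇒-refl

⋁ : List Form → Form
⋁ []      = ⊥'
⋁ (A ∷ Γ) = A ∨' ⋁ Γ

∈⇒⋁ : A ∈ Γ → ⊢ A ⇒ ⋁ Γ
∈⇒⋁ (here refl) = ax (weak _ _)
∈⇒⋁ (there A∈Γ) = ⇒-trans (∈⇒⋁ A∈Γ) ∨-injʳ

⊆⇒⋁ : Γ ⊆ Δ → ⊢ ⋁ Γ ⇒ ⋁ Δ
⊆⇒⋁ {[]}    _   = ⊥'-elim
⊆⇒⋁ {A ∷ Γ} Γ⊆Δ = ∨-elim (∈⇒⋁ (Γ⊆Δ (here refl))) (⊆⇒⋁ (Γ⊆Δ ∘ there))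

⋁-swap : ⊢ ⋁ (A ∷ B ∷ Γ) → ⊢ ⋁ (B ∷ A ∷ Γ)
⋁-swap p = mp p (⊆⇒⋁ (⊆-reflexive-↭ (↭-swap _ _ ↭-refl)))

⋁-complementary : A ∈ Γ → ¬' A ∈ Γ → ⊢ ⋁ Γ
⋁-complementary A∈Γ ¬A∈Γ = mp ⇒-refl (∨-elim (∈⇒⋁ ¬A∈Γ) (∈⇒⋁ A∈Γ))

⋁-singleton : ⊢ ⋁ (A ∷ []) → ⊢ A
⋁-singleton p = mp p (∨-elim ⇒-refl ⊥'-elim)

data PropForm : Set where
  atom : ℕ → PropForm
  neg  : PropForm → PropForm
  _or_ : PropForm → PropForm → PropForm

infixr 5 _or_
infixr 4 _and_
infixr 3 _imp_

_imp_ : PropForm → PropForm → PropForm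
p imp q = neg p or q

_and_ : PropForm → PropForm → PropForm
p and q = neg (neg p or neg q)

⟦_⟧ : (ℕ → Form) → PropForm → Form
⟦ ρ ⟧ (atom i) = ρ i
⟦ ρ ⟧ (neg p)  = ¬' ⟦ ρ ⟧ p
⟦ ρ ⟧ (p or q) = ⟦ ρ ⟧ p ∨' ⟦ ρ ⟧ q

eval : (ℕ → Bool) → PropForm → Bool
eval w (atom i) = w i
eval w (neg p)  = not (eval w p)
eval w (p or q) = eval w p ∨ eval w q

AtomsBelow : ℕ → PropForm → Set
AtomsBelow k (atom i) = i < k
AtomsBelow k (neg p)  = AtomsBelow k p
AtomsBelow k (p or q) = AtomsBelow k p × AtomsBelow k q

atomBound : PropForm → ℕ
atomBound (atom i) = suc i
atomBound (neg p)  = atomBound p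
atomBound (p or q) = atomBound p ⊔ atomBound q

atomsBelow-mono : ∀ {k l} p → AtomsBelow k p → k ≤ l → AtomsBelow l p
atomsBelow-mono (atom i) i<k k≤l           = ≤-trans i<k k≤l
atomsBelow-mono (neg p)  below k≤l         = atomsBelow-mono p below k≤l
atomsBelow-mono (p or q) (below₁ , below₂) k≤l =
  atomsBelow-mono p below₁ k≤l , atomsBelow-mono q below₂ k≤l

atomsBelow-atomBound : ∀ p → AtomsBelow (atomBound p) p
atomsBelow-atomBound (atom i) = ≤-refl
atomsBelow-atomBound (neg p)  = atomsBelow-atomBound p
atomsBelow-atomBound (p or q) =
  atomsBelow-mono p (atomsBelow-atomBound p) (m≤m⊔n _ _) ,
  atomsBelow-mono q (atomsBelow-atomBound q) (m≤n⊔m _ _)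

literal : Bool → Form → Form
literal true  A = A
literal false A = ¬' A

-- ⊢ ⋁ (A ∷ denials ρ w k) says that A follows from the literals of w on the atoms below k.
denials : (ℕ → Form) → (ℕ → Bool) → ℕ → List Form
denials ρ w zero    = []
denials ρ w (suc k) = ¬' literal (w k) (ρ k) ∷ denials ρ w k

denial∈denials : ∀ ρ w {i} k → i < k → ¬' literal (w i) (ρ i) ∈ denials ρ w k
denial∈denials ρ w (suc k) i<1+k with m<1+n⇒m<n∨m≡n i<1+k
... | inj₁ i<k  = there (denial∈denials ρ w k i<k)
... | inj₂ refl = here refl

kalmar : ∀ ρ w k p → AtomsBelow k p → ⊢ ⋁ (literal (eval w p) (⟦ ρ ⟧ p) ∷ denials ρ w k)
kalmar ρ w k (atom i) i<k = ⋁-complementary (here refl) (there (denial∈denials ρ w k i<k))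
kalmar ρ w k (neg p) below with eval w p | kalmar ρ w k p below
... | true  | ⊢p  = mp ⊢p (∨-monoˡ excluded-middle)
... | false | ⊢¬p = ⊢¬p
kalmar ρ w k (p or q) (below₁ , below₂)
  with eval w p | kalmar ρ w k p below₁ | eval w q | kalmar ρ w k q below₂
... | true  | ⊢p  | _     | _   = mp ⊢p (∨-monoˡ (ax (weak _ _)))
... | false | _   | true  | ⊢q  = mp ⊢q (∨-monoˡ ∨-injʳ)
... | false | ⊢¬p | false | ⊢¬q = ∨-elim ⊢¬p ⊢¬q

_[_↦_] : (ℕ → Bool) → ℕ → Bool → ℕ → Bool
(w [ k ↦ b ]) i = if i ≡ᵇ k then b else w i

≡ᵇ-refl : ∀ k → (k ≡ᵇ k) ≡ true
≡ᵇ-refl zero    = refl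
≡ᵇ-refl (suc k) = ≡ᵇ-refl k

<⇒≡ᵇ-false : ∀ {j k} → j < k → (j ≡ᵇ k) ≡ false
<⇒≡ᵇ-false {zero}  {suc k} _         = refl
<⇒≡ᵇ-false {suc j} {suc k} (s≤s j<k) = <⇒≡ᵇ-false j<k

denials-update-above : ∀ ρ w k b j → j ≤ k → denials ρ (w [ k ↦ b ]) j ≡ denials ρ w j
denials-update-above ρ w k b zero    _ = refl
denials-update-above ρ w k b (suc j) j<k
  rewrite <⇒≡ᵇ-false j<k | denials-update-above ρ w k b j (<⇒≤ j<k) = refl

denials-update : ∀ ρ w k b →
  denials ρ (w [ k ↦ b ]) (suc k) ≡ ¬' literal b (ρ k) ∷ denials ρ w k
denials-update ρ w k b rewrite ≡ᵇ-refl k | denials-update-above ρ w k b k ≤-refl = refl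

trueOnExtensions : PropForm → (ℕ → Bool) → ℕ → ℕ → Bool
trueOnExtensions p w k zero    = eval w p
trueOnExtensions p w k (suc m) =
  trueOnExtensions p (w [ k ↦ true ]) (suc k) m ∧ trueOnExtensions p (w [ k ↦ false ]) (suc k) m

isTautology : PropForm → Bool
isTautology p = trueOnExtensions p (λ _ → false) 0 (atomBound p)

eliminate-atoms : ∀ ρ p m k w → AtomsBelow (m + k) p → T (trueOnExtensions p w k m) →
                  ⊢ ⋁ (⟦ ρ ⟧ p ∷ denials ρ w k)
eliminate-atoms ρ p zero k w below true-p with eval w p | kalmar ρ w k p below
... | true  | ⊢p = ⊢p
... | false | _  = ⊥-elim true-p
eliminate-atoms ρ p (suc m) k w below true-p =
  mp excluded-middle (∨-elim (⋁-swap (case true (proj₁ both))) (⋁-swap (case false (proj₂ both))))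
  where
  both : T (trueOnExtensions p (w [ k ↦ true ]) (suc k) m) ×
         T (trueOnExtensions p (w [ k ↦ false ]) (suc k) m)
  both = Equivalence.to T-∧ true-p
  case : ∀ b → T (trueOnExtensions p (w [ k ↦ b ]) (suc k) m) →
         ⊢ ⋁ (⟦ ρ ⟧ p ∷ ¬' literal b (ρ k) ∷ denials ρ w k)
  case b t = subst (λ Γ → ⊢ ⋁ (⟦ ρ ⟧ p ∷ Γ)) (denials-update ρ w k b)
    (eliminate-atoms ρ p m (suc k) (w [ k ↦ b ])
      (subst (λ n → AtomsBelow n p) (sym (+-suc m k)) below) t)

tautology : ∀ ρ p → T (isTautology p) → ⊢ ⟦ ρ ⟧ p
tautology ρ p taut = ⋁-singleton (eliminate-atoms ρ p (atomBound p) 0 (λ _ → false)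
  (subst (λ n → AtomsBelow n p) (sym (+-identityʳ _)) (atomsBelow-atomBound p)) taut)

atoms : List Form → ℕ → Form
atoms []      _       = ⊥'
atoms (A ∷ Γ) zero    = A
atoms (A ∷ Γ) (suc i) = atoms Γ i

taut : ∀ Γ p → {T (isTautology p)} → ⊢ ⟦ atoms Γ ⟧ p
taut Γ p {t} = tautology (atoms Γ) p t

infix 2 _⊢_

_⊢_ : Form → Form → Set
H ⊢ X = ⊢ H ⇒ X

weaken : ⊢ X → H ⊢ X
weaken {X} {H} p = mp p (taut (X ∷ H ∷ []) (atom 0 imp atom 1 imp atom 0))

mpʰ : H ⊢ X → H ⊢ X ⇒ Y → H ⊢ Y
mpʰ {H} {X} {Y} p q = mp q (mp p (taut (H ∷ X ∷ Y ∷ [])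
  ((atom 0 imp atom 1) imp (atom 0 imp atom 1 imp atom 2) imp atom 0 imp atom 2)))

applyʰ : ⊢ X ⇒ Y → H ⊢ X → H ⊢ Y
applyʰ f p = mpʰ p (weaken f)

apply₂ʰ : ⊢ X ⇒ Y ⇒ W → H ⊢ X → H ⊢ Y → H ⊢ W
apply₂ʰ f p q = mpʰ q (applyʰ f p)

∧-proj₁ : H ∧' X ⊢ H
∧-proj₁ {H} {X} = taut (H ∷ X ∷ []) (atom 0 and atom 1 imp atom 0)

∧-proj₂ : H ∧' X ⊢ X
∧-proj₂ {H} {X} = taut (H ∷ X ∷ []) (atom 0 and atom 1 imp atom 1)

dropʰ : H ⊢ Y → H ∧' X ⊢ Y
dropʰ p = ⇒-trans ∧-proj₁ p

deduction : H ∧' X ⊢ W → H ⊢ X ⇒ W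
deduction {H} {X} {W} p = mp p (taut (H ∷ X ∷ W ∷ [])
  ((atom 0 and atom 1 imp atom 2) imp atom 0 imp atom 1 imp atom 2))

casesʰ : H ⊢ X ∨' Y → H ∧' X ⊢ W → H ∧' Y ⊢ W → H ⊢ W
casesʰ {H} {X} {Y} {W} p q r = mp r (mp q (mp p (taut (H ∷ X ∷ Y ∷ W ∷ [])
  ((atom 0 imp atom 1 or atom 2) imp (atom 0 and atom 1 imp atom 3) imp
   (atom 0 and atom 2 imp atom 3) imp atom 0 imp atom 3))))

absurdʰ : H ⊢ X → H ⊢ ¬' X → H ⊢ W
absurdʰ {H} {X} {W} p q = mp q (mp p (taut (H ∷ X ∷ W ∷ [])
  ((atom 0 imp atom 1) imp (atom 0 imp neg (atom 1)) imp atom 0 imp atom 2)))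

inlʰ : H ⊢ X → H ⊢ X ∨' Y
inlʰ = applyʰ (ax (weak _ _))

inrʰ : H ⊢ Y → H ⊢ X ∨' Y
inrʰ = applyʰ ∨-injʳ

⇒-contrapose : ⊢ X ⇒ Y → ⊢ ¬' Y ⇒ ¬' X
⇒-contrapose {X} {Y} p = mp p (taut (X ∷ Y ∷ [])
  ((atom 0 imp atom 1) imp neg (atom 1) imp neg (atom 0)))

∨-mono : ⊢ A ⇒ B → ⊢ X ⇒ Y → ⊢ A ∨' X ⇒ B ∨' Y
∨-mono p q = ⇒-trans (∨-monoˡ p) (∨-monoʳ q)

x₀ x₁ x₂ □ : Tm
x₀ = var 0
x₁ = var 1
x₂ = var 2
□  = var 9

-- x≔ (a₀ ∷ … ∷ aₙ₋₁ ∷ []) substitutes aᵢ for xᵢ and fixes every other variable.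
x≔ : List Tm → ℕ → Tm
x≔ = shifted 0
  where
  shifted : ℕ → List Tm → ℕ → Tm
  shifted n []       i       = var (n + i)
  shifted n (a ∷ ts) zero    = a
  shifted n (a ∷ ts) (suc i) = shifted (suc n) ts i

-- Rewriting happens inside a template: a formula mentioning the hole □ and no other
-- variable beyond x₈, so that subF (plug a b) A computes to A with a in the hole.
plug : Tm → Tm → ℕ → Tm
plug a b 9  = a
plug a b 10 = b
plug a b n  = var n

leibniz : ∀ A {a b} → a ≐ b ⊢ subF (plug a b) A ⇒ subF (plug a b) (A [ 9 ≔ var 10 ]F)
leibniz A {a} {b} = deduction (inst (plug a b) (ax (leib 9 10 A)))

≐-substʰ : ∀ A {a b} → H ⊢ a ≐ b → H ⊢ subF (plug a b) A → H ⊢ subF (plug a b) (A [ 9 ≔ var 10 ]F)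
≐-substʰ A = apply₂ʰ (leibniz A)

≐-subst : ∀ A {a b} → ⊢ a ≐ b → ⊢ subF (plug a b) A → ⊢ subF (plug a b) (A [ 9 ≔ var 10 ]F)
≐-subst A e p = mp p (mp e (leibniz A))

≐-refl : ∀ t → ⊢ t ≐ t
≐-refl t = inst (x≔ (t ∷ [])) (ax (refl' 0))

≐-sym⇒ : a ≐ b ⊢ b ≐ a
≐-sym⇒ {a} {b} = inst (x≔ (a ∷ b ∷ [])) (ax (sym' 0 1))

≐-trans⇒ : a ≐ b ⊢ b ≐ c ⇒ a ≐ c
≐-trans⇒ {a} {b} {c} = mp (deduction (inst (x≔ (b ∷ c ∷ a ∷ [])) (ax (leib 0 1 (x₂ ≐ x₀)))))
  (taut ((b ≐ c) ∷ (a ≐ b) ∷ (a ≐ c) ∷ [])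
    ((atom 0 imp atom 1 imp atom 2) imp atom 1 imp atom 0 imp atom 2))

≐-sym : ⊢ a ≐ b → ⊢ b ≐ a
≐-sym p = mp p ≐-sym⇒

≐-trans : ⊢ a ≐ b → ⊢ b ≐ c → ⊢ a ≐ c
≐-trans p q = mp q (mp p ≐-trans⇒)

≐-symʰ : H ⊢ a ≐ b → H ⊢ b ≐ a
≐-symʰ = applyʰ ≐-sym⇒

infixr 4 _∙_

_∙_ : H ⊢ a ≐ b → H ⊢ b ≐ c → H ⊢ a ≐ c
p ∙ q = apply₂ʰ ≐-trans⇒ p q

P : ∀ {V} → Term V → Term V
P t = app predF (t ∷ [])

S-cong : a ≐ b ⊢ S a ≐ S b
S-cong {a} {b} = inst (x≔ (a ∷ b ∷ []))
  (≐-substʰ (S x₀ ≐ S □) {x₀} {x₁} ⇒-refl (weaken (≐-refl (S x₀))))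

pred-cong : a ≐ b ⊢ P a ≐ P b
pred-cong {a} {b} = inst (x≔ (a ∷ b ∷ []))
  (≐-substʰ (P x₀ ≐ P □) {x₀} {x₁} ⇒-refl (weaken (≐-refl (P x₀))))

monus-congˡ : a ≐ b ⊢ c -ₜ a ≐ c -ₜ b
monus-congˡ {a} {b} {c} = inst (x≔ (a ∷ b ∷ c ∷ []))
  (≐-substʰ (x₂ -ₜ x₀ ≐ x₂ -ₜ □) {x₀} {x₁} ⇒-refl (weaken (≐-refl (x₂ -ₜ x₀))))

plus-congʳ : a ≐ b ⊢ a +ₜ c ≐ b +ₜ c
plus-congʳ {a} {b} {c} = inst (x≔ (a ∷ b ∷ c ∷ []))
  (≐-substʰ (x₀ +ₜ x₂ ≐ □ +ₜ x₂) {x₀} {x₁} ⇒-refl (weaken (≐-refl (x₀ +ₜ x₂))))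

plus-congˡ : a ≐ b ⊢ c +ₜ a ≐ c +ₜ b
plus-congˡ {a} {b} {c} = inst (x≔ (a ∷ b ∷ c ∷ []))
  (≐-substʰ (x₂ +ₜ x₀ ≐ x₂ +ₜ □) {x₀} {x₁} ⇒-refl (weaken (≐-refl (x₂ +ₜ x₀))))

cond-cong : ∀ {d} → a ≐ b ⊢ Cₜ a c d ≐ Cₜ b c d
cond-cong {a} {b} {c} {d} = inst (x≔ (a ∷ b ∷ c ∷ d ∷ []))
  (≐-substʰ (Cₜ x₀ x₂ x₃ ≐ Cₜ □ x₂ x₃) {x₀} {x₁} ⇒-refl (weaken (≐-refl (Cₜ x₀ x₂ x₃))))
  where
  x₃ : Tm
  x₃ = var 3

pred-zero : ⊢ P Z ≐ Z
pred-zero = ax (defZ Z (var yv))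

pred-suc : ∀ a → ⊢ P (S a) ≐ a
pred-suc a = inst (x≔ (a ∷ [])) (ax (defS Z (var yv)))

monus-zero : ∀ a → ⊢ a -ₜ Z ≐ a
monus-zero a = inst (x≔ (a ∷ [])) (ax (defZ (var fzero) (P (var zv))))

monus-suc : ∀ a b → ⊢ a -ₜ S b ≐ P (a -ₜ b)
monus-suc a b = inst (x≔ (a ∷ b ∷ [])) (ax (defS (var fzero) (P (var zv))))

plus-zero : ∀ a → ⊢ a +ₜ Z ≐ a
plus-zero a = inst (x≔ (a ∷ [])) (ax (defZ (var fzero) (S (var zv))))

plus-suc : ∀ a b → ⊢ a +ₜ S b ≐ S (a +ₜ b)
plus-suc a b = inst (x≔ (a ∷ b ∷ [])) (ax (defS (var fzero) (S (var zv))))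

cond-zero : ∀ b c → ⊢ Cₜ Z b c ≐ b
cond-zero b c = inst (x≔ (b ∷ c ∷ [])) (ax (defZ (var fzero) (var (xv (fsuc fzero)))))

cond-suc : ∀ a b c → ⊢ Cₜ (S a) b c ≐ c
cond-suc a b c = inst (x≔ (b ∷ c ∷ a ∷ [])) (ax (defS (var fzero) (var (xv (fsuc fzero)))))

S≠Z : ∀ a → ⊢ S a ≠' Z
S≠Z a = inst (x≔ (a ∷ [])) (ax (sucNZ 0))

zero-or-suc : ∀ t → ⊢ t ≐ Z ∨' t ≐ S (P t)
zero-or-suc t = inst (x≔ (t ∷ [])) (ind (x₀ ≐ Z ∨' x₀ ≐ S (P x₀)) 0 0 (inj₁ refl)
  (mp (≐-refl Z) (ax (weak _ _)))
  (weaken (mp (≐-sym (mp (pred-suc x₀) S-cong)) ∨-injʳ)))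

monus-suc-suc : ∀ a b → ⊢ S a -ₜ S b ≐ a -ₜ b
monus-suc-suc a b =
  inst (x≔ (a ∷ b ∷ [])) (ind (S x₀ -ₜ S x₁ ≐ x₀ -ₜ x₁) 1 1 (inj₁ refl) base step)
  where
  base : ⊢ S x₀ -ₜ S Z ≐ x₀ -ₜ Z
  base = ≐-trans (monus-suc (S x₀) Z) (≐-trans (mp (monus-zero (S x₀)) pred-cong)
           (≐-trans (pred-suc x₀) (≐-sym (monus-zero x₀))))
  step : S x₀ -ₜ S x₁ ≐ x₀ -ₜ x₁ ⊢ S x₀ -ₜ S (S x₁) ≐ x₀ -ₜ S x₁
  step = weaken (monus-suc (S x₀) (S x₁)) ∙ applyʰ pred-cong ⇒-refl
       ∙ weaken (≐-sym (monus-suc x₀ x₁))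

monus-self : ∀ a → ⊢ a -ₜ a ≐ Z
monus-self a = inst (x≔ (a ∷ [])) (ind (x₀ -ₜ x₀ ≐ Z) 0 0 (inj₁ refl)
  (monus-zero Z) (weaken (monus-suc-suc x₀ x₀) ∙ ⇒-refl))

plus-zero-invʳ : ∀ a b → a +ₜ b ≐ Z ⊢ b ≐ Z
plus-zero-invʳ a b =
  casesʰ (weaken (zero-or-suc b)) ∧-proj₂ (absurdʰ sum≐Z (weaken (S≠Z (a +ₜ P b))))
  where
  sum≐Z : a +ₜ b ≐ Z ∧' b ≐ S (P b) ⊢ S (a +ₜ P b) ≐ Z
  sum≐Z = ≐-symʰ (weaken (plus-suc a (P b))) ∙ ≐-symʰ (applyʰ plus-congˡ ∧-proj₂) ∙ ∧-proj₁

plus-zero-invˡ : ∀ a b → a +ₜ b ≐ Z ⊢ a ≐ Z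
plus-zero-invˡ a b =
  weaken (≐-sym (plus-zero a)) ∙ applyʰ plus-congˡ (≐-symʰ (plus-zero-invʳ a b)) ∙ ⇒-refl

Antisym : Tm → Tm → Form
Antisym a b = a -ₜ b ≐ Z ⇒ b -ₜ a ≐ Z ⇒ a ≐ b

antisym-zeroˡ : ∀ b → ⊢ Antisym Z b
antisym-zeroˡ b = weaken (≐-symʰ (weaken (≐-sym (monus-zero b)) ∙ ⇒-refl))

antisym-suc-zero : ∀ a → ⊢ Antisym (S a) Z
antisym-suc-zero a = absurdʰ (weaken (≐-sym (monus-zero (S a))) ∙ ⇒-refl) (weaken (S≠Z a))

antisym-suc : ∀ a b → Antisym a b ⊢ Antisym (S a) (S b)
antisym-suc a b =
  deduction (deduction (applyʰ S-cong (mpʰ b∸a≐Z (mpʰ a∸b≐Z (dropʰ ∧-proj₁)))))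
  where
  a∸b≐Z : (Antisym a b ∧' S a -ₜ S b ≐ Z) ∧' S b -ₜ S a ≐ Z ⊢ a -ₜ b ≐ Z
  a∸b≐Z = weaken (≐-sym (monus-suc-suc a b)) ∙ dropʰ ∧-proj₂
  b∸a≐Z : (Antisym a b ∧' S a -ₜ S b ≐ Z) ∧' S b -ₜ S a ≐ Z ⊢ b -ₜ a ≐ Z
  b∸a≐Z = weaken (≐-sym (monus-suc-suc b a)) ∙ ∧-proj₂

antisym-pred : ∀ a b → Antisym (P a) (P b) ⊢ Antisym a b
antisym-pred a b = inst (x≔ (a ∷ b ∷ []))
  (casesʰ (weaken (zero-or-suc x₀)) x₀-zero (casesʰ (weaken (zero-or-suc x₁)) x₁-zero x₁-suc))
  where
  H₀ : Form
  H₀ = Antisym (P x₀) (P x₁)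
  x₀-zero : H₀ ∧' x₀ ≐ Z ⊢ Antisym x₀ x₁
  x₀-zero = ≐-substʰ (Antisym □ x₁) (≐-symʰ ∧-proj₂) (weaken (antisym-zeroˡ x₁))
  x₁-zero : (H₀ ∧' x₀ ≐ S (P x₀)) ∧' x₁ ≐ Z ⊢ Antisym x₀ x₁
  x₁-zero = ≐-substʰ (Antisym x₀ □) (≐-symʰ ∧-proj₂)
    (≐-substʰ (Antisym □ Z) (≐-symʰ (dropʰ ∧-proj₂)) (weaken (antisym-suc-zero (P x₀))))
  x₁-suc : (H₀ ∧' x₀ ≐ S (P x₀)) ∧' x₁ ≐ S (P x₁) ⊢ Antisym x₀ x₁
  x₁-suc = ≐-substʰ (Antisym x₀ □) (≐-symʰ ∧-proj₂)
    (≐-substʰ (Antisym □ (S (P x₁))) (≐-symʰ (dropʰ ∧-proj₂))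
      (applyʰ (antisym-suc (P x₀) (P x₁)) (dropʰ ∧-proj₁)))

-- Induction on x₀ with x₁ generalised is not available in a quantifier-free system.
-- Instead, with m = x₀ ∸ k, Descent k is Antisym (x₀ ∸ m) (x₁ ∸ m): it holds at k = 0
-- since x₀ ∸ x₀ = 0, passes from k to S k by antisym-pred, and is Antisym x₀ x₁ at k = x₀.
Descent : Tm → Form
Descent k = Antisym (x₀ -ₜ (x₀ -ₜ k)) (x₁ -ₜ (x₀ -ₜ k))

descent : ⊢ Descent x₂
descent = ind (Descent x₂) 2 2 (inj₁ refl) base (casesʰ (weaken (zero-or-suc m)) m-zero m-suc)
  where
  base : ⊢ Descent Z
  base = ≐-subst (Antisym (x₀ -ₜ (x₀ -ₜ Z)) □) (mp (≐-sym (monus-zero x₀)) monus-congˡ)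
    (≐-subst (Antisym □ (x₁ -ₜ x₀))
      (≐-sym (≐-trans (mp (monus-zero x₀) monus-congˡ) (monus-self x₀)))
      (antisym-zeroˡ (x₁ -ₜ x₀)))
  m m′ : Tm
  m  = x₀ -ₜ x₂
  m′ = x₀ -ₜ S x₂
  m-zero : Descent x₂ ∧' m ≐ Z ⊢ Descent (S x₂)
  m-zero = ≐-substʰ (Antisym (x₀ -ₜ □) (x₁ -ₜ □))
    (≐-symʰ (weaken (monus-suc x₀ x₂) ∙ applyʰ pred-cong ∧-proj₂ ∙ weaken pred-zero
             ∙ ≐-symʰ ∧-proj₂))
    ∧-proj₁
  unfold : ∀ c → Descent x₂ ∧' m ≐ S (P m) ⊢ c -ₜ m ≐ P (c -ₜ m′)
  unfold c = applyʰ monus-congˡ ∧-proj₂ ∙ weaken (monus-suc c (P m))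
    ∙ weaken (≐-sym (mp (mp (monus-suc x₀ x₂) monus-congˡ) pred-cong))
  m-suc : Descent x₂ ∧' m ≐ S (P m) ⊢ Descent (S x₂)
  m-suc = applyʰ (antisym-pred (x₀ -ₜ m′) (x₁ -ₜ m′))
    (≐-substʰ (Antisym (P (x₀ -ₜ m′)) □) (unfold x₁)
      (≐-substʰ (Antisym □ (x₁ -ₜ m)) (unfold x₀) ∧-proj₁))

antisym : ∀ a b → ⊢ Antisym a b
antisym a b = inst (x≔ (a ∷ b ∷ [])) (≐-subst (Antisym x₀ □) (monus-monus-self x₁)
  (≐-subst (Antisym □ (x₁ -ₜ (x₀ -ₜ x₀))) (monus-monus-self x₀)
    (inst (x≔ (x₀ ∷ x₁ ∷ x₀ ∷ [])) descent)))
  where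
  monus-monus-self : ∀ c → ⊢ c -ₜ (x₀ -ₜ x₀) ≐ c
  monus-monus-self c = ≐-trans (mp (monus-self x₀) monus-congˡ) (monus-zero c)

≐̇-intro : ∀ a b → a ≐ b ⊢ (a ≐̇ b) ≐ Z
≐̇-intro a b =
  inst (x≔ (a ∷ b ∷ [])) (≐-substʰ ((x₀ ≐̇ □) ≐ Z) {x₀} {x₁} ⇒-refl (weaken x₀≐̇x₀))
  where
  x₀≐̇x₀ : ⊢ (x₀ ≐̇ x₀) ≐ Z
  x₀≐̇x₀ = ≐-trans (mp (≐-trans (mp (monus-self x₀) plus-congʳ)
                              (≐-trans (mp (monus-self x₀) plus-congˡ) (plus-zero Z))) cond-cong)
                  (cond-zero Z (S Z))

≐̇-elim : ∀ a b → (a ≐̇ b) ≐ Z ⊢ a ≐ b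
≐̇-elim a b = casesʰ (weaken (zero-or-suc (Eqₜ a b))) Eq-zero Eq-suc
  where
  Eq-zero : (a ≐̇ b) ≐ Z ∧' Eqₜ a b ≐ Z ⊢ a ≐ b
  Eq-zero = mpʰ (applyʰ (plus-zero-invʳ (a -ₜ b) (b -ₜ a)) ∧-proj₂)
              (mpʰ (applyʰ (plus-zero-invˡ (a -ₜ b) (b -ₜ a)) ∧-proj₂) (weaken (antisym a b)))
  Eq-suc : (a ≐̇ b) ≐ Z ∧' Eqₜ a b ≐ S (P (Eqₜ a b)) ⊢ a ≐ b
  Eq-suc = absurdʰ (≐-symʰ (weaken (cond-suc (P (Eqₜ a b)) Z (S Z)))
                     ∙ ≐-symʰ (applyʰ cond-cong ∧-proj₂) ∙ ∧-proj₁)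
                   (weaken (S≠Z Z))

¬̇-intro : ∀ a → ¬' (a ≐ Z) ⊢ (¬̇ a) ≐ Z
¬̇-intro a = casesʰ (weaken (zero-or-suc a)) (absurdʰ ∧-proj₂ ∧-proj₁)
  (applyʰ cond-cong ∧-proj₂ ∙ weaken (cond-suc (P a) (S Z) Z))

¬̇-elim : ∀ a → (¬̇ a) ≐ Z ⊢ ¬' (a ≐ Z)
¬̇-elim a = inst (x≔ (a ∷ [])) (casesʰ (weaken (zero-or-suc x₀)) x₀-zero x₀-suc)
  where
  x₀-zero : (¬̇ x₀) ≐ Z ∧' x₀ ≐ Z ⊢ ¬' (x₀ ≐ Z)
  x₀-zero = absurdʰ (≐-symʰ (weaken (cond-zero (S Z) Z)) ∙ ≐-symʰ (applyʰ cond-cong ∧-proj₂)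
                      ∙ ∧-proj₁)
                    (weaken (S≠Z Z))
  x₀-suc : (¬̇ x₀) ≐ Z ∧' x₀ ≐ S (P x₀) ⊢ ¬' (x₀ ≐ Z)
  x₀-suc = ≐-substʰ (¬' (□ ≐ Z)) (≐-symʰ ∧-proj₂) (weaken (S≠Z (P x₀)))

∨̇-intro : ∀ a b → a ≐ Z ∨' b ≐ Z ⊢ (a ∨̇ b) ≐ Z
∨̇-intro a b = casesʰ ⇒-refl (a-zero ∧-proj₂) (casesʰ (weaken (zero-or-suc a)) (a-zero ∧-proj₂)
  (applyʰ cond-cong ∧-proj₂ ∙ weaken (cond-suc (P a) Z (Cₜ b Z (S Z)))
   ∙ applyʰ cond-cong (dropʰ ∧-proj₂) ∙ weaken (cond-zero Z (S Z))))
  where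
  a-zero : H ⊢ a ≐ Z → H ⊢ (a ∨̇ b) ≐ Z
  a-zero a≐Z = applyʰ cond-cong a≐Z ∙ weaken (cond-zero Z (Cₜ b Z (S Z)))

∨̇-elim : ∀ a b → (a ∨̇ b) ≐ Z ⊢ a ≐ Z ∨' b ≐ Z
∨̇-elim a b = casesʰ (weaken (zero-or-suc a)) (inlʰ ∧-proj₂)
  (casesʰ (weaken (zero-or-suc b)) (inrʰ ∧-proj₂) both-suc)
  where
  both-suc : ((a ∨̇ b) ≐ Z ∧' a ≐ S (P a)) ∧' b ≐ S (P b) ⊢ a ≐ Z ∨' b ≐ Z
  both-suc = absurdʰ (≐-symʰ (weaken (cond-suc (P b) Z (S Z))) ∙ ≐-symʰ (applyʰ cond-cong ∧-proj₂)
                      ∙ ≐-symʰ (weaken (cond-suc (P a) Z (Cₜ b Z (S Z))))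
                      ∙ ≐-symʰ (applyʰ cond-cong (dropʰ ∧-proj₂)) ∙ dropʰ ∧-proj₁)
                     (weaken (S≠Z Z))

χ-intro : ∀ A → A ⊢ χ A ≐ Z
χ-elim  : ∀ A → χ A ≐ Z ⊢ A

χ-intro (a ≐ b)  = ≐̇-intro a b
χ-intro (¬' B)   = ⇒-trans (⇒-contrapose (χ-elim B)) (¬̇-intro (χ B))
χ-intro (B ∨' C) = ⇒-trans (∨-mono (χ-intro B) (χ-intro C)) (∨̇-intro (χ B) (χ C))

χ-elim (a ≐ b)  = ≐̇-elim a b
χ-elim (¬' B)   = ⇒-trans (¬̇-elim (χ B)) (⇒-contrapose (χ-intro B))
χ-elim (B ∨' C) = ⇒-trans (∨̇-elim (χ B) (χ C)) (∨-mono (χ-elim B) (χ-elim C))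

χ-correct : ∀ A → (⊢ A) ⇔ (⊢ χ A ≐ Z)
χ-correct A = mk⇔ (λ ⊢A → mp ⊢A (χ-intro A)) (λ ⊢χA → mp ⊢χA (χ-elim A))

sub-χ : ∀ σ A → sub σ (χ A) ≡ χ (subF σ A)
sub-χ σ (a ≐ b)  = refl
sub-χ σ (¬' A)   = cong ¬̇_ (sub-χ σ A)
sub-χ σ (A ∨' B) = cong₂ _∨̇_ (sub-χ σ A) (sub-χ σ B)

occ-Z : ¬ OccT v Z
occ-Z (inArg ())

occ-SZ : ¬ OccT v (S Z)
occ-SZ (inArg (hd o)) = occ-Z o
occ-SZ (inArg (tl ()))

occ-app₂ : ∀ {f : Fun 2} → OccT v (app f (a ∷ b ∷ [])) → OccT v a ⊎ OccT v b
occ-app₂ (inArg (hd o))      = inj₁ o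
occ-app₂ (inArg (tl (hd o))) = inj₂ o
occ-app₂ (inArg (tl (tl ())))

occ-Eq : OccT v (Eqₜ a b) → OccT v a ⊎ OccT v b
occ-Eq o = [ occ-app₂ , swap ∘ occ-app₂ ]′ (occ-app₂ o)

occ-C : OccT v (Cₜ a b c) → OccT v a ⊎ OccT v b ⊎ OccT v c
occ-C (inArg (hd o))           = inj₂ (inj₁ o)
occ-C (inArg (tl (hd o)))      = inj₂ (inj₂ o)
occ-C (inArg (tl (tl (hd o)))) = inj₁ o
occ-C (inArg (tl (tl (tl ()))))

occ-χ : ∀ A → OccT v (χ A) → OccF v A
occ-χ (a ≐ b)  o = [ occ-Eq , ⊥-elim ∘ [ occ-Z , occ-SZ ]′ ]′ (occ-C o)
occ-χ (¬' A)   o = [ occ-χ A , ⊥-elim ∘ [ occ-SZ , occ-Z ]′ ]′ (occ-C o)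
occ-χ (A ∨' B) o = [ inj₁ ∘ occ-χ A , [ ⊥-elim ∘ occ-Z , inj₂ ∘ occ-χB ]′ ]′ (occ-C o)
  where
  occ-χB : OccT v (Cₜ (χ B) Z (S Z)) → OccF v B
  occ-χB o′ = [ occ-χ B , ⊥-elim ∘ [ occ-Z , occ-SZ ]′ ]′ (occ-C o′)

⊢⇒⊢χ : ⊢ A → ⊢χ χ A
⊢⇒⊢χ (ax d)        = axχ d
⊢⇒⊢χ (inst σ p)    = subst ⊢χ_ (sub-χ σ _) (instχ σ (⊢⇒⊢χ p))
⊢⇒⊢χ (mp p q)      = mpχ (⊢⇒⊢χ p) (⊢⇒⊢χ q)
⊢⇒⊢χ (ind A x x′ fresh base step) =
  indχ (χ A) x x′ (Sum.map₂ (_∘ occ-χ A) fresh)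
    (subst ⊢χ_ (sym (sub-χ ⟨ x ≔ Z ⟩ A)) (⊢⇒⊢χ base))
    (subst ⊢χ_ (sym (cong₂ _→̇_ (sub-χ ⟨ x ≔ var x′ ⟩ A) (sub-χ ⟨ x ≔ S (var x′) ⟩ A))) (⊢⇒⊢χ step))

χ-mp : ∀ α β → (α →̇ β) ≐ Z ⊢ α ≐ Z ⇒ β ≐ Z
χ-mp α β = mp (¬̇-elim α) (mp (∨̇-elim (¬̇ α) β)
  (taut (((α →̇ β) ≐ Z) ∷ ((¬̇ α) ≐ Z) ∷ (β ≐ Z) ∷ (α ≐ Z) ∷ [])
    ((atom 0 imp atom 1 or atom 2) imp (atom 1 imp neg (atom 3)) imp atom 0 imp atom 3 imp atom 2)))

⊢χ⇒⊢≐Z : ∀ {α} → ⊢χ α → ⊢ α ≐ Z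
⊢χ⇒⊢≐Z (axχ d)     = mp (ax d) (χ-intro _)
⊢χ⇒⊢≐Z (instχ σ p) = inst σ (⊢χ⇒⊢≐Z p)
⊢χ⇒⊢≐Z (mpχ {α} {β} p q) = mp (⊢χ⇒⊢≐Z p) (mp (⊢χ⇒⊢≐Z q) (χ-mp α β))
⊢χ⇒⊢≐Z (indχ α x x′ fresh base step) =
  ind (α ≐ Z) x x′ (Sum.map₂ (λ x′∉α → [ x′∉α , occ-Z ]′) fresh)
    (⊢χ⇒⊢≐Z base) (mp (⊢χ⇒⊢≐Z step) (χ-mp _ _))

proposition3 : (A : Form) →
    ((⊢ A) ⇔ (⊢ χ A ≐ Z)) × ((⊢ A) ⇔ (⊢χ χ A))
proposition3 A = χ-correct A , mk⇔ ⊢⇒⊢χ (Equivalence.from (χ-correct A) ∘ ⊢χ⇒⊢≐Z)
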